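{- Fix $n\in\mathbb{N}$ and let $\alpha=(a_1,\dots,a_n)$ be a parking preference of length $n$. Define $\mathrm{T}(\alpha)=(\tau(a_1),\dots,\tau(a_n))$, where, for $i=1,\dots,n$ in order, $$\tau(a_i)=\begin{cases} a_i & \text{if } i=1, \text{ or } a_i=1, \text{ or } (a_i\neq 1 \text{ and } a_i\neq \tau(a_j) \text{ for all } 1\leq j<i),\\ a_i-1 & \text{if } a_i\neq 1 \text{ and } a_i=\tau(a_j) \text{ for some } 1\leq j<i.\end{cases}$$ Then $\alpha$ is a Naples parking function of length $n$ if and only if $\mathrm{T}(\alpha)$ is a (classical) parking function of length $n$.
   Context: A parking preference of length $n$ is a tuple $(a_1,\dots,a_n)\in\{1,\dots,n\}^n$; car $c_i$ prefers spot $a_i$, and cars $c_1,\dots,c_n$ arrive in order to a one-way street with spots $1,\dots,n$ from west to east. Under the classical rule, car $c_i$ parks in the first empty spot among $a_i,a_i+1,\dots,n$ (failing if there is none); the preference is a parking function if all cars park. Under the Naples rule, car $c_i$ parks at $a_i$ if it is empty; otherwise, if $a_i-1\geq 1$ and spot $a_i-1$ is empty, it parks there; otherwise it parks in the first empty spot among $a_i+1,\dots,n$ (failing if there is none). The preference is a Naples parking function if all cars park under the Naples rule. -}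

module Defs where

open import Data.Nat using (ℕ; zero; suc; _∸_; _≤_; _≡ᵇ_; _≤ᵇ_)
open import Data.Bool using (Bool; true; false; if_then_else_; _∧_; not)
open import Data.List using (List; []; _∷_)
open import Data.Bool.ListAction using (any)
open import Data.Vec using (Vec; toList)
open import Data.Vec.Relation.Unary.All using (All)
open import Data.Maybe using (Maybe; just; nothing; is-just)
open import Data.Product using (_×_)

IsPreference : (n : ℕ) → Vec ℕ n → Set
IsPreference n α = All (λ a → 1 ≤ a × a ≤ n) α

occupied : List ℕ → ℕ → Bool
occupied []      s = false
occupied (x ∷ o) s = (x ≡ᵇ s) Data.Bool.∨ occupied o s

firstEmptyFrom : (n : ℕ) → List ℕ → ℕ → Maybe ℕ
firstEmptyFrom n o s = go (suc n ∸ s) s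
  where
  go : ℕ → ℕ → Maybe ℕ
  go zero    t = nothing
  go (suc k) t = if occupied o t then go k (suc t) else just t

classicalSpot : (n : ℕ) → List ℕ → ℕ → Maybe ℕ
classicalSpot n o a = firstEmptyFrom n o a

naplesSpot : (n : ℕ) → List ℕ → ℕ → Maybe ℕ
naplesSpot n o a =
  if not (occupied o a) then just a
  else if (2 ≤ᵇ a) ∧ not (occupied o (a ∸ 1)) then just (a ∸ 1)
  else firstEmptyFrom n o (suc a)

runAll : (List ℕ → ℕ → Maybe ℕ) → List ℕ → List ℕ → Bool
runAll rule o []       = true
runAll rule o (a ∷ as) with rule o a
... | nothing = false
... | just s  = runAll rule (s ∷ o) as

IsParkingFunction : (n : ℕ) → Vec ℕ n → Set
IsParkingFunction n α = IsPreference n α × runAll (classicalSpot n) [] (toList α) ≡ true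
  where open import Relation.Binary.PropositionalEquality using (_≡_)

IsNaplesParkingFunction : (n : ℕ) → Vec ℕ n → Set
IsNaplesParkingFunction n α = IsPreference n α × runAll (naplesSpot n) [] (toList α) ≡ true
  where open import Relation.Binary.PropositionalEquality using (_≡_)

-- the map T.  `prev` is the list of already computed values τ(a_j), j < i.
-- τ(aᵢ) = aᵢ - 1 if aᵢ ≠ 1 and aᵢ = τ(a_j) for some j < i, otherwise aᵢ
-- (for i = 1 the list prev is empty, so τ(a₁) = a₁).
τ : List ℕ → ℕ → ℕ
τ prev a = if not (a ≡ᵇ 1) ∧ any (λ t → t ≡ᵇ a) prev then a ∸ 1 else a

Tgo : {m : ℕ} → List ℕ → Vec ℕ m → Vec ℕ m
Tgo prev Vec.[] = Vec.[]
Tgo prev (a Vec.∷ as) = τ prev a Vec.∷ Tgo (τ prev a ∷ prev) as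

T : {n : ℕ} → Vec ℕ n → Vec ℕ n
T α = Tgo [] α

module Submission where

-- Run the Naples process on α and the classical process on
-- T(α) side by side.  We show that, car by car, both processes park the
-- car in the SAME spot (or both fail), so the two runs accept or reject
-- together.  This rests on an invariant relating the list O of occupied
-- spots (common to both runs) with the list P of values τ(a_j) computed so
-- far:
--   (1) every value in P is an occupied spot, and
--   (2) every occupied spot x is in P or has x - 1 occupied.
-- Given the invariant, a Naples car with preference a behaves exactly like
-- a classical car with preference τ(a): if a ∈ P then a is taken, and the
-- Naples detour to a - 1 is the classical search started at a - 1; if
-- a ∉ P and a is taken then a - 1 is taken too, so the Naples rule never
-- backs up and agrees with the classical search from a.  Conversely the
-- invariant survives parking a classical car, because the first empty spot
-- found from t is t itself or lies just past an occupied spot.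

open import Defs
open import Data.Nat using (ℕ; zero; suc; _∸_; _≤_; _<_; _≡ᵇ_; _≤?_; z≤n; s≤s)
open import Data.Nat.Properties
  using (+-∸-assoc; m≤n⇒m∸n≡0; ≤-trans; n≤1+n; ≡ᵇ⇒≡; ≡⇒≡ᵇ; suc-injective; ≰⇒>)
open import Data.Bool using (true; false; if_then_else_; _∨_)
open import Data.Bool.Properties using (∨-zeroʳ; T-≡)
open import Data.Bool.ListAction using (any)
open import Data.List using (List; []; _∷_)
open import Data.Vec using (Vec; toList)
open import Data.Vec.Relation.Unary.All using (All; []; _∷_)
open import Data.Maybe using (just; nothing)
open import Data.Maybe.Properties using (just-injective)
open import Data.Product using (_×_; _,_)
open import Data.Sum using (_⊎_; inj₁; inj₂)
open import Relation.Nullary using (yes; no)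
open import Function.Bundles using (_⇔_; mk⇔; Equivalence)
open import Relation.Binary.PropositionalEquality

Taken : List ℕ → ℕ → Set
Taken o x = occupied o x ≡ true

taken-here : ∀ o x → Taken (x ∷ o) x
taken-here o x rewrite Equivalence.to T-≡ (≡⇒≡ᵇ x x refl) = refl

taken-there : ∀ y o x → Taken o x → Taken (y ∷ o) x
taken-there y o x taken rewrite taken = ∨-zeroʳ (y ≡ᵇ x)

taken-cons : ∀ y o x → Taken (y ∷ o) x → y ≡ x ⊎ Taken o x
taken-cons y o x taken with y ≡ᵇ x in y≡ᵇx
... | true  = inj₁ (≡ᵇ⇒≡ y x (Equivalence.from T-≡ y≡ᵇx))
... | false = inj₂ taken

any-≡ᵇ-is-occupied : ∀ P x → any (λ t → t ≡ᵇ x) P ≡ occupied P x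
any-≡ᵇ-is-occupied []      x = refl
any-≡ᵇ-is-occupied (y ∷ P) x = cong ((y ≡ᵇ x) ∨_) (any-≡ᵇ-is-occupied P x)

firstEmptyFrom-step : ∀ n o t → t ≤ n →
  firstEmptyFrom n o t ≡ (if occupied o t then firstEmptyFrom n o (suc t) else just t)
firstEmptyFrom-step n o t t≤n rewrite +-∸-assoc 1 t≤n = refl

firstEmptyFrom-past-end : ∀ n o t → n < t → firstEmptyFrom n o t ≡ nothing
firstEmptyFrom-past-end n o t n<t rewrite m≤n⇒m∸n≡0 n<t = refl

firstEmptyFrom-found : ∀ n o t s → firstEmptyFrom n o t ≡ just s →
  s ≡ t ⊎ (Taken o (s ∸ 1) × Taken o t)
firstEmptyFrom-found n o t₀ s = search (suc n ∸ t₀) t₀ refl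
  where
  search : ∀ k t → suc n ∸ t ≡ k → firstEmptyFrom n o t ≡ just s →
    s ≡ t ⊎ (Taken o (s ∸ 1) × Taken o t)
  search k t k≡ found with t ≤? n
  ... | no t≰n with trans (sym (firstEmptyFrom-past-end n o t (≰⇒> t≰n))) found
  ...   | ()
  search zero t k≡ found | yes t≤n with trans (sym (+-∸-assoc 1 t≤n)) k≡
  ...   | ()
  search (suc k) t k≡ found | yes t≤n
    rewrite firstEmptyFrom-step n o t t≤n with occupied o t in t-taken
  ...   | false = inj₁ (sym (just-injective found))
  ...   | true with search k (suc t) (suc-injective (trans (sym (+-∸-assoc 1 t≤n)) k≡)) found
  -- (in this branch `Taken o t` has been specialised to `true ≡ true`)
  ...     | inj₁ refl         = inj₂ (t-taken , refl)
  ...     | inj₂ (below , _)  = inj₂ (below , refl)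

record Synced (O P : List ℕ) : Set where
  field
    τ-values-taken : ∀ x → Taken P x → Taken O x
    taken-explained : ∀ x → Taken O x → Taken P x ⊎ Taken O (x ∸ 1)
open Synced

synced-start : Synced [] []
synced-start = record { τ-values-taken = λ _ () ; taken-explained = λ _ () }

synced-park : ∀ n O P t s → Synced O P → firstEmptyFrom n O t ≡ just s →
  Synced (s ∷ O) (t ∷ P)
synced-park n O P t s sync found =
  record { τ-values-taken = still-taken ; taken-explained = explained }
  where
  still-taken : ∀ x → Taken (t ∷ P) x → Taken (s ∷ O) x
  still-taken x x∈tP with taken-cons t P x x∈tP
  ... | inj₂ x∈P = taken-there s O x (τ-values-taken sync x x∈P)
  ... | inj₁ refl with firstEmptyFrom-found n O t s found
  ...   | inj₁ refl        = taken-here O s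
  ...   | inj₂ (_ , t∈O)   = taken-there s O t t∈O
  explained : ∀ x → Taken (s ∷ O) x → Taken (t ∷ P) x ⊎ Taken (s ∷ O) (x ∸ 1)
  explained x x∈sO with taken-cons s O x x∈sO
  ... | inj₂ x∈O with taken-explained sync x x∈O
  ...   | inj₁ x∈P   = inj₁ (taken-there t P x x∈P)
  ...   | inj₂ x-1∈O = inj₂ (taken-there s O (x ∸ 1) x-1∈O)
  explained x x∈sO | inj₁ refl with firstEmptyFrom-found n O t s found
  ...   | inj₁ refl        = inj₁ (taken-here P s)
  ...   | inj₂ (s-1∈O , _) = inj₂ (taken-there s O (s ∸ 1) s-1∈O)

-- A Naples car preferring spot 1 cannot back up: it parks classically.
naples-at-1 : ∀ n O → 1 ≤ n → naplesSpot n O 1 ≡ firstEmptyFrom n O 1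
naples-at-1 n O 1≤n rewrite firstEmptyFrom-step n O 1 1≤n with occupied O 1
... | true  = refl
... | false = refl

naples-when-taken : ∀ n O b → suc (suc b) ≤ n → Taken O (suc (suc b)) →
  naplesSpot n O (suc (suc b)) ≡ firstEmptyFrom n O (suc b)
naples-when-taken n O b a≤n a-taken
  rewrite firstEmptyFrom-step n O (suc b) (≤-trans (n≤1+n (suc b)) a≤n)
        | firstEmptyFrom-step n O (suc (suc b)) a≤n
        | a-taken
  with occupied O (suc b)
... | true  = refl
... | false = refl

naples-without-backup : ∀ n O b → suc (suc b) ≤ n →
  (Taken O (suc (suc b)) → Taken O (suc b)) →
  naplesSpot n O (suc (suc b)) ≡ firstEmptyFrom n O (suc (suc b))
naples-without-backup n O b a≤n below-taken
  rewrite firstEmptyFrom-step n O (suc (suc b)) a≤n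
  with occupied O (suc (suc b))
... | false = refl
-- spot a is taken here, so the hypothesis (now specialised) gives a - 1 taken
... | true rewrite below-taken refl = refl

naples≡classical-τ : ∀ n O P a → 1 ≤ a → a ≤ n → Synced O P →
  naplesSpot n O a ≡ classicalSpot n O (τ P a)
naples≡classical-τ n O P (suc zero) _ a≤n sync = naples-at-1 n O a≤n
naples≡classical-τ n O P (suc (suc b)) _ a≤n sync
  with any (λ t → t ≡ᵇ suc (suc b)) P in a-in-P?
... | true = naples-when-taken n O b a≤n (τ-values-taken sync _ a∈P)
  where
  a∈P : Taken P (suc (suc b))
  a∈P = trans (sym (any-≡ᵇ-is-occupied P _)) a-in-P?
... | false = naples-without-backup n O b a≤n below-taken
  where
  below-taken : Taken O (suc (suc b)) → Taken O (suc b)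
  below-taken a-taken with taken-explained sync _ a-taken
  ... | inj₂ a-1-taken = a-1-taken
  ... | inj₁ a∈P with trans (sym a-in-P?) (trans (any-≡ᵇ-is-occupied P _) a∈P)
  ...   | ()

OnStreet : ℕ → ℕ → Set
OnStreet n a = 1 ≤ a × a ≤ n

-- τ keeps a preference on the street (it moves it west only from a ≥ 2).
τ-on-street : ∀ n P a → OnStreet n a → OnStreet n (τ P a)
τ-on-street n P (suc zero) on = on
τ-on-street n P (suc (suc b)) (_ , a≤n) with any (λ t → t ≡ᵇ suc (suc b)) P
... | true  = s≤s z≤n , ≤-trans (n≤1+n (suc b)) a≤n
... | false = s≤s z≤n , a≤n

Tgo-on-street : ∀ n {m} P (α : Vec ℕ m) → All (OnStreet n) α → All (OnStreet n) (Tgo P α)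
Tgo-on-street n P Vec.[]       []            = []
Tgo-on-street n P (a Vec.∷ α) (on ∷ ons) =
  τ-on-street n P a on ∷ Tgo-on-street n (τ P a ∷ P) α ons

runs-agree : ∀ n {m} O P (α : Vec ℕ m) → All (OnStreet n) α → Synced O P →
  runAll (naplesSpot n) O (toList α) ≡ runAll (classicalSpot n) O (toList (Tgo P α))
runs-agree n O P Vec.[]       []                 sync = refl
runs-agree n O P (a Vec.∷ α) ((1≤a , a≤n) ∷ ons) sync
  with naples≡classical-τ n O P a 1≤a a≤n sync
... | same-spot with naplesSpot n O a | classicalSpot n O (τ P a) in found
...   | nothing | nothing = refl
...   | just s  | just _ with same-spot
...     | refl = runs-agree n (s ∷ O) (τ P a ∷ P) α ons (synced-park n O P (τ P a) s sync found)

theorem1p2 : (n : ℕ) → (α : Vec ℕ n) → IsPreference n α →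
    IsNaplesParkingFunction n α ⇔ IsParkingFunction n (T α)
theorem1p2 n α pref = mk⇔
  (λ { (_ , naples-ok) → Tgo-on-street n [] α pref , trans (sym agree) naples-ok })
  (λ { (_ , classical-ok) → pref , trans agree classical-ok })
  where
  agree : runAll (naplesSpot n) [] (toList α) ≡ runAll (classicalSpot n) [] (toList (T α))
  agree = runs-agree n [] [] α pref synced-start
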